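{- Let $k$ be an integer with $k\equiv 2 \pmod 4$ and $k \geq 6$, and let $p$ be a prime with $p \equiv 7 \pmod 8$. Let $n$ be a positive integer with $n\equiv 1 \pmod 8$ and $n<p$, such that either $n=1$ or every prime factor of $n$ is congruent to $1 \pmod 4$. Then there are no positive integers $x,y,z$ with $z$ even and $x^2+y^2+z^k=(np)^2$. -}

{-# OPTIONS --safe #-}
module Submission where

-- Write k = 2(2 + j) and w = z^(2+j), so that x² + y² = (N − w)(N + w) with N = np. As
-- N ≡ 3 (mod 4) and 4 ∣ w, the factor N − w is ≡ 3 (mod 4). A prime q ≡ 3 (mod 4) dividing
-- x² + y² divides x and y (Fermat's little theorem), so dividing out q² repeatedly shows that
-- some such q divides both N − w and N + w. Then q divides 2w, hence z, and N; the hypothesis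
-- on n forces q = p, and p² ≤ z² ≤ w ≤ N = np < p² is absurd.

open import Data.Nat
open import Data.Nat.Properties
open import Data.Nat.DivMod
open import Data.Nat.Divisibility
open import Data.Nat.Primality
open import Data.Nat.Combinatorics using (_C_; nCn≡1; nCk≡n!/k![n-k]!; k![n∸k]!∣n!)
open import Data.Nat.Induction using (<-rec)
open import Data.Nat.Tactic.RingSolver using (solve-∀)
open import Data.Fin using (Fin; toℕ; fromℕ; inject₁) renaming (zero to fzero; suc to fsuc)
open import Data.Fin.Properties using (toℕ-fromℕ; toℕ-inject₁; toℕ<n)
open import Data.Vec.Functional using (init)
open import Data.Product using (_×_; ∃; _,_)
open import Data.Sum using (_⊎_; inj₁; inj₂; [_,_]′)
open import Function using (_∘_; id)
open import Relation.Nullary using (¬_; yes; no; contradiction)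
open import Relation.Binary.PropositionalEquality
open import Algebra.Properties.CommutativeSemiring.Binomial +-*-commutativeSemiring
  using (theorem; binomialTerm)
open import Algebra.Properties.Monoid.Sum +-0-monoid using (sum; sum-init-last)
open import Algebra.Definitions.RawMonoid +-0-rawMonoid using () renaming (_×_ to _×ₘ_)
open import Algebra.Definitions.RawSemiring +-*-rawSemiring using () renaming (_^_ to _^ₛ_)

×ₘ≡* : ∀ n x → n ×ₘ x ≡ n * x
×ₘ≡* zero    x = refl
×ₘ≡* (suc n) x = cong (x +_) (×ₘ≡* n x)

^ₛ≡^ : ∀ x n → x ^ₛ n ≡ x ^ n
^ₛ≡^ x zero    = refl
^ₛ≡^ x (suc n) = cong (x *_) (^ₛ≡^ x n)

∣-sum : ∀ {d n} (f : Fin n → ℕ) → (∀ i → d ∣ f i) → d ∣ sum f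
∣-sum {n = zero}  f d∣f = _ ∣0
∣-sum {n = suc n} f d∣f = ∣m∣n⇒∣m+n (d∣f fzero) (∣-sum (f ∘ fsuc) (d∣f ∘ fsuc))

prime∤1 : ∀ {p} → Prime p → ¬ p ∣ 1
prime∤1 pp p∣1 = ¬prime[1] (subst Prime (∣1⇒≡1 p∣1) pp)

prime∣m!⇒p≤m : ∀ {p} → Prime p → ∀ m → p ∣ m ! → p ≤ m
prime∣m!⇒p≤m pp zero    p∣1 = contradiction p∣1 (prime∤1 pp)
prime∣m!⇒p≤m pp (suc m) p∣m! with euclidsLemma (suc m) (m !) pp p∣m!
... | inj₁ p∣1+m = ∣⇒≤ p∣1+m
... | inj₂ p∣m!  = m≤n⇒m≤1+n (prime∣m!⇒p≤m pp m p∣m!)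

nCk*k!*[n∸k]!≡n! : ∀ n k → k ≤ n → (n C k) * (k ! * (n ∸ k) !) ≡ n !
nCk*k!*[n∸k]!≡n! n k k≤n = begin
  (n C k) * (k ! * (n ∸ k) !)
    ≡⟨ cong (_* (k ! * (n ∸ k) !)) (nCk≡n!/k![n-k]! k≤n) ⟩
  (n ! / (k ! * (n ∸ k) !)) {{k !* (n ∸ k) !≢0}} * (k ! * (n ∸ k) !)
    ≡⟨ m/n*n≡m {{k !* (n ∸ k) !≢0}} (k![n∸k]!∣n! k≤n) ⟩
  n ! ∎
  where open ≡-Reasoning

p∣pCk : ∀ {p k} → Prime p → 0 < k → k < p → p ∣ p C k
p∣pCk {p@(suc p-1)} {k} pp 0<k k<p
  with euclidsLemma (p C k) (k ! * (p ∸ k) !) pp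
         (subst (p ∣_) (sym (nCk*k!*[n∸k]!≡n! p k (<⇒≤ k<p))) (m∣m*n (p-1 !)))
... | inj₁ p∣pCk = p∣pCk
... | inj₂ p∣k!*[p∸k]! with euclidsLemma (k !) ((p ∸ k) !) pp p∣k!*[p∸k]!
...   | inj₁ p∣k!     = contradiction (prime∣m!⇒p≤m pp k p∣k!) (<⇒≱ k<p)
...   | inj₂ p∣[p∸k]! =
  contradiction (prime∣m!⇒p≤m pp (p ∸ k) p∣[p∸k]!) (<⇒≱ (∸-monoʳ-< 0<k (<⇒≤ k<p)))

freshmansDream : ∀ {p} → Prime p → ∀ a → ∃ λ s → p ∣ s × (a + 1) ^ p ≡ 1 + s + a ^ p
freshmansDream {p@(suc (suc r))} pp a = middle , p∣middle , expansion
  where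
    T : Fin (suc p) → ℕ
    T = binomialTerm a 1 p

    middle : ℕ
    middle = sum (init (T ∘ fsuc))

    term≡ : ∀ i → T i ≡ (p C toℕ i) * (a ^ₛ toℕ i * 1 ^ₛ (p ∸ toℕ i))
    term≡ i = ×ₘ≡* (p C toℕ i) _

    p∣middle : p ∣ middle
    p∣middle = ∣-sum _ λ i → subst (p ∣_) (sym (term≡ (fsuc (inject₁ i))))
      (∣m⇒∣m*n _ (p∣pCk pp (s≤s z≤n)
        (s≤s (subst (_< suc r) (sym (toℕ-inject₁ i)) (toℕ<n i)))))

    first : T fzero ≡ 1
    first = trans (term≡ fzero) (cong (λ u → (p C 0) * (1 * u)) (trans (^ₛ≡^ 1 p) (^-zeroˡ p)))

    last : T (fsuc (fromℕ (suc r))) ≡ a ^ p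
    last = begin
      T (fsuc (fromℕ (suc r)))                ≡⟨ term≡ (fsuc (fromℕ (suc r))) ⟩
      topTerm (toℕ (fromℕ (suc r)))           ≡⟨ cong topTerm (toℕ-fromℕ (suc r)) ⟩
      (p C p) * (a ^ₛ p * 1 ^ₛ (r ∸ r))
        ≡⟨ cong₂ (λ c e → c * (a ^ₛ p * 1 ^ₛ e)) (nCn≡1 p) (n∸n≡0 r) ⟩
      1 * (a ^ₛ p * 1)                        ≡⟨ trans (*-identityˡ _) (*-identityʳ _) ⟩
      a ^ₛ p                                  ≡⟨ ^ₛ≡^ a p ⟩
      a ^ p                                   ∎
      where
        open ≡-Reasoning
        topTerm : ℕ → ℕ
        topTerm t = (p C suc t) * (a ^ₛ suc t * 1 ^ₛ (suc r ∸ t))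

    expansion : (a + 1) ^ p ≡ 1 + middle + a ^ p
    expansion = begin
      (a + 1) ^ p                                ≡⟨ sym (^ₛ≡^ (a + 1) p) ⟩
      (a + 1) ^ₛ p                               ≡⟨ theorem p a 1 ⟩
      T fzero + sum (T ∘ fsuc)                   ≡⟨ cong (T fzero +_) (sum-init-last (T ∘ fsuc)) ⟩
      T fzero + (middle + T (fsuc (fromℕ (suc r)))) ≡⟨ sym (+-assoc (T fzero) middle _) ⟩
      T fzero + middle + T (fsuc (fromℕ (suc r)))   ≡⟨ cong₂ (λ u v → u + middle + v) first last ⟩
      1 + middle + a ^ p                         ∎
      where open ≡-Reasoning

fermatsLittleTheorem : ∀ {p} .{{_ : NonZero p}} → Prime p → ∀ a → a ^ p % p ≡ a % p
fermatsLittleTheorem {suc _} pp zero    = refl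
fermatsLittleTheorem {p}     pp (suc a) with freshmansDream pp a
... | s , p∣s , expansion = begin
  suc a ^ p % p               ≡⟨ cong (λ b → b ^ p % p) (+-comm 1 a) ⟩
  (a + 1) ^ p % p             ≡⟨ cong (_% p) expansion ⟩
  (1 + s + a ^ p) % p         ≡⟨ cong (_% p) (trans (cong (_+ a ^ p) (+-comm 1 s)) (+-assoc s 1 (a ^ p))) ⟩
  (s + (1 + a ^ p)) % p       ≡⟨ %-remove-+ˡ (1 + a ^ p) p∣s ⟩
  (1 + a ^ p) % p             ≡⟨ %-distribˡ-+ 1 (a ^ p) p ⟩
  (1 % p + a ^ p % p) % p     ≡⟨ cong (λ b → (1 % p + b) % p) (fermatsLittleTheorem pp a) ⟩
  (1 % p + a % p) % p         ≡⟨ sym (%-distribˡ-+ 1 a p) ⟩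
  suc a % p                   ∎
  where open ≡-Reasoning

%-*-congˡ : ∀ {d} .{{_ : NonZero d}} m {n o} → n % d ≡ o % d → (m * n) % d ≡ (m * o) % d
%-*-congˡ {d} m {n} {o} n≡o = begin
  (m * n) % d               ≡⟨ %-distribˡ-* m n d ⟩
  (m % d * (n % d)) % d     ≡⟨ cong (λ t → (m % d * t) % d) n≡o ⟩
  (m % d * (o % d)) % d     ≡⟨ sym (%-distribˡ-* m o d) ⟩
  (m * o) % d               ∎
  where open ≡-Reasoning

[m*n]%d≡m%d : ∀ m {n d} .{{_ : NonZero d}} → n % d ≡ 1 → (m * n) % d ≡ m % d
[m*n]%d≡m%d m {n} {d} n%d≡1 = begin
  (m * n) % d           ≡⟨ %-distribˡ-* m n d ⟩
  (m % d * (n % d)) % d ≡⟨ cong (λ t → (m % d * t) % d) n%d≡1 ⟩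
  (m % d * 1) % d       ≡⟨ cong (_% d) (*-identityʳ (m % d)) ⟩
  m % d % d             ≡⟨ m%n%n≡m%n m d ⟩
  m % d                 ∎
  where open ≡-Reasoning

%4≡3⇒2<n : ∀ {n} → n % 4 ≡ 3 → 2 < n
%4≡3⇒2<n {n} n%4≡3 = subst (_≤ n) n%4≡3 (m%n≤m n 4)

%4≡3⇒nonZero : ∀ {n} → n % 4 ≡ 3 → NonZero n
%4≡3⇒nonZero n%4≡3 = >-nonZero (<-trans (s≤s z≤n) (%4≡3⇒2<n n%4≡3))

%4≡3⇒≡3+4*[n/4] : ∀ {n} → n % 4 ≡ 3 → n ≡ 3 + 4 * (n / 4)
%4≡3⇒≡3+4*[n/4] {n} n%4≡3 =
  trans (m≡m%n+[m/n]*n n 4) (cong₂ _+_ n%4≡3 (*-comm (n / 4) 4))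

%4≡3⇒[n*n]%4≡1 : ∀ n → n % 4 ≡ 3 → (n * n) % 4 ≡ 1
%4≡3⇒[n*n]%4≡1 n n%4≡3 = trans (%-distribˡ-* n n 4) (cong (λ t → (t * t) % 4) n%4≡3)

[m*n]%4≡3⇒m%4≡3⊎n%4≡3 : ∀ m n → (m * n) % 4 ≡ 3 → m % 4 ≡ 3 ⊎ n % 4 ≡ 3
[m*n]%4≡3⇒m%4≡3⊎n%4≡3 m n mn%4≡3 = residues (m % 4) (n % 4) (m%n<n m 4) (m%n<n n 4)
  (trans (sym (%-distribˡ-* m n 4)) mn%4≡3)
  where
    residues : ∀ a b → a < 4 → b < 4 → (a * b) % 4 ≡ 3 → a ≡ 3 ⊎ b ≡ 3
    residues 3 b _ _ _ = inj₁ refl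
    residues a 3 _ _ _ = inj₂ refl
    residues 0 b _ _ ()
    residues 1 0 _ _ ()
    residues 1 1 _ _ ()
    residues 1 2 _ _ ()
    residues 2 0 _ _ ()
    residues 2 1 _ _ ()
    residues 2 2 _ _ ()
    residues (suc (suc (suc (suc _)))) _ (s≤s (s≤s (s≤s (s≤s ())))) _ _
    residues 1 (suc (suc (suc (suc _)))) _ (s≤s (s≤s (s≤s (s≤s ())))) _
    residues 2 (suc (suc (suc (suc _)))) _ (s≤s (s≤s (s≤s (s≤s ())))) _

prime>2∧∣2*n⇒∣n : ∀ {p n} → Prime p → 2 < p → p ∣ 2 * n → p ∣ n
prime>2∧∣2*n⇒∣n {p} {n} pp 2<p p∣2n with euclidsLemma 2 n pp p∣2n
... | inj₁ p∣2 = contradiction (∣⇒≤ p∣2) (<⇒≱ 2<p)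
... | inj₂ p∣n = p∣n

prime∣m^n⇒∣m : ∀ {p} → Prime p → ∀ m n → p ∣ m ^ n → p ∣ m
prime∣m^n⇒∣m pp m zero    p∣1 = contradiction p∣1 (prime∤1 pp)
prime∣m^n⇒∣m pp m (suc n) p∣m^[1+n] with euclidsLemma m (m ^ n) pp p∣m^[1+n]
... | inj₁ p∣m   = p∣m
... | inj₂ p∣m^n = prime∣m^n⇒∣m pp m n p∣m^n

m^2≡m*m : ∀ m → m ^ 2 ≡ m * m
m^2≡m*m m = cong (m *_) (*-identityʳ m)

2∣m⇒4∣m^[2+n] : ∀ {m} n → 2 ∣ m → 4 ∣ m ^ (2 + n)
2∣m⇒4∣m^[2+n] {m} n 2∣m = *-pres-∣ 2∣m (∣m⇒∣m*n (m ^ n) 2∣m)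

x^[3+4r]≡x*[x*x*[[x*x]*[x*x]]^r] : ∀ x r → x ^ (3 + 4 * r) ≡ x * (x * x * (x * x * (x * x)) ^ r)
x^[3+4r]≡x*[x*x*[[x*x]*[x*x]]^r] x r = begin
  x ^ (3 + 4 * r)                          ≡⟨ ^-distribˡ-+-* x 3 (4 * r) ⟩
  x ^ 3 * x ^ (4 * r)                      ≡⟨ cong (x ^ 3 *_) (sym (^-*-assoc x 4 r)) ⟩
  x ^ 3 * (x ^ 4) ^ r                      ≡⟨ cong (λ t → x ^ 3 * t ^ r) (x^4≡ x) ⟩
  x ^ 3 * (x * x * (x * x)) ^ r            ≡⟨ regroup x ((x * x * (x * x)) ^ r) ⟩
  x * (x * x * (x * x * (x * x)) ^ r)      ∎
  where
    open ≡-Reasoning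
    x^4≡ : ∀ x → x * (x * (x * (x * 1))) ≡ x * x * (x * x)
    x^4≡ = solve-∀
    regroup : ∀ x t → x * (x * (x * 1)) * t ≡ x * (x * x * t)
    regroup = solve-∀

∣a+b⇒∣a*[a*a]^n+b*[b*b]^n : ∀ {d} a b → d ∣ a + b → ∀ n → d ∣ a * (a * a) ^ n + b * (b * b) ^ n
∣a+b⇒∣a*[a*a]^n+b*[b*b]^n {d} a b d∣a+b zero =
  subst (d ∣_) (sym (cong₂ _+_ (*-identityʳ a) (*-identityʳ b))) d∣a+b
∣a+b⇒∣a*[a*a]^n+b*[b*b]^n {d} a b d∣a+b (suc n) =
  ∣m+n∣m⇒∣n (subst (d ∣_) (sym (factor a b A B)) (∣m⇒∣m*n _ d∣a+b))
            (∣n⇒∣m*n (a * b) (∣a+b⇒∣a*[a*a]^n+b*[b*b]^n a b d∣a+b n))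
  where
    A = (a * a) ^ n
    B = (b * b) ^ n
    factor : ∀ a b A B → a * b * (a * A + b * B) + (a * (a * a * A) + b * (b * b * B))
                       ≡ (a + b) * (a * a * A + b * b * B)
    factor = solve-∀

-- With q = 3 + 4r and U = x²(x⁴)^r, Fermat gives x·U ≡ x (mod q), and q ∣ U + V because U + V
-- is an odd power sum of x² and y². Hence 2xy ≡ y·xU + x·yV = xy(U + V) ≡ 0 (mod q).
prime≡3[4]∣x²+y²⇒∣x*y : ∀ {q} → Prime q → q % 4 ≡ 3 → ∀ x y → q ∣ x * x + y * y → q ∣ x * y
prime≡3[4]∣x²+y²⇒∣x*y {q} pq q%4≡3 x y q∣x²+y² =
  prime>2∧∣2*n⇒∣n pq (%4≡3⇒2<n q%4≡3) (m%n≡0⇒n∣m _ q 2xy%q≡0)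
  where
    instance _ = prime⇒nonZero pq
    r = q / 4
    U = x * x * (x * x * (x * x)) ^ r
    V = y * y * (y * y * (y * y)) ^ r

    fermat : ∀ a → (a * (a * a * (a * a * (a * a)) ^ r)) % q ≡ a % q
    fermat a = begin
      (a * (a * a * (a * a * (a * a)) ^ r)) % q
        ≡⟨ cong (_% q) (sym (x^[3+4r]≡x*[x*x*[[x*x]*[x*x]]^r] a r)) ⟩
      a ^ (3 + 4 * r) % q
        ≡⟨ cong (λ e → a ^ e % q) (sym (%4≡3⇒≡3+4*[n/4] {q} q%4≡3)) ⟩
      a ^ q % q
        ≡⟨ fermatsLittleTheorem pq a ⟩
      a % q
        ∎
      where open ≡-Reasoning

    q∣U+V : q ∣ U + V
    q∣U+V = ∣a+b⇒∣a*[a*a]^n+b*[b*b]^n (x * x) (y * y) q∣x²+y² r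

    2xy%q≡0 : 2 * (x * y) % q ≡ 0
    2xy%q≡0 = begin
      2 * (x * y) % q
        ≡⟨ cong (_% q) (double x y) ⟩
      (y * x + x * y) % q
        ≡⟨ %-distribˡ-+ (y * x) (x * y) q ⟩
      ((y * x) % q + (x * y) % q) % q
        ≡⟨ cong₂ (λ s t → (s + t) % q) (%-*-congˡ {q} y (sym (fermat x))) (%-*-congˡ {q} x (sym (fermat y))) ⟩
      ((y * (x * U)) % q + (x * (y * V)) % q) % q
        ≡⟨ sym (%-distribˡ-+ (y * (x * U)) (x * (y * V)) q) ⟩
      (y * (x * U) + x * (y * V)) % q
        ≡⟨ cong (_% q) (factor x y U V) ⟩
      (x * y * (U + V)) % q
        ≡⟨ n∣m⇒m%n≡0 _ q (∣n⇒∣m*n (x * y) q∣U+V) ⟩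
      0
        ∎
      where
        open ≡-Reasoning
        double : ∀ x y → 2 * (x * y) ≡ y * x + x * y
        double = solve-∀
        factor : ∀ x y U V → y * (x * U) + x * (y * V) ≡ x * y * (U + V)
        factor = solve-∀

prime≡3[4]∣x²+y²⇒∣x : ∀ {q} → Prime q → q % 4 ≡ 3 → ∀ x y → q ∣ x * x + y * y → q ∣ x
prime≡3[4]∣x²+y²⇒∣x pq q%4≡3 x y q∣x²+y²
  with euclidsLemma x y pq (prime≡3[4]∣x²+y²⇒∣x*y pq q%4≡3 x y q∣x²+y²)
... | inj₁ q∣x = q∣x
... | inj₂ q∣y = [ id , id ]′ (euclidsLemma x x pq (∣m+n∣n⇒∣m q∣x²+y² (∣m⇒∣m*n y q∣y)))
  where
    ∣m+n∣n⇒∣m : ∀ {d m n} → d ∣ m + n → d ∣ n → d ∣ m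
    ∣m+n∣n⇒∣m {d} {m} {n} d∣m+n = ∣m+n∣m⇒∣n (subst (d ∣_) (+-comm m n) d∣m+n)

prime≡3[4]-divideOut : ∀ {q} → Prime q → q % 4 ≡ 3 → ∀ m n x y → m * q * n ≡ x * x + y * y
  → ∃ λ x′ → ∃ λ y′ → m * n ≡ q * (x′ * x′ + y′ * y′)
prime≡3[4]-divideOut {q} pq q%4≡3 m n x y mqn≡x²+y²
  with prime≡3[4]∣x²+y²⇒∣x pq q%4≡3 x y q∣x²+y²
     | prime≡3[4]∣x²+y²⇒∣x pq q%4≡3 y x (subst (q ∣_) (+-comm (x * x) (y * y)) q∣x²+y²)
  where q∣x²+y² = subst (q ∣_) mqn≡x²+y² (n∣m*n*o m n)
... | divides x′ refl | divides y′ refl = x′ , y′ , *-cancelˡ-≡ _ _ q {{prime⇒nonZero pq}} (begin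
  q * (m * n)                                    ≡⟨ rearrange q m n ⟩
  m * q * n                                      ≡⟨ mqn≡x²+y² ⟩
  x′ * q * (x′ * q) + y′ * q * (y′ * q)          ≡⟨ factor q x′ y′ ⟩
  q * (q * (x′ * x′ + y′ * y′))                  ∎)
  where
    open ≡-Reasoning
    rearrange : ∀ q m n → q * (m * n) ≡ m * q * n
    rearrange = solve-∀
    factor : ∀ q a b → a * q * (a * q) + b * q * (b * q) ≡ q * (q * (a * a + b * b))
    factor = solve-∀

∃prime≡3[4]∣ : ∀ n → n % 4 ≡ 3 → ∃ λ q → Prime q × q % 4 ≡ 3 × q ∣ n
∃prime≡3[4]∣ = <-rec (λ n → n % 4 ≡ 3 → P n) step
  where
    P : ℕ → Set
    P n = ∃ λ q → Prime q × q % 4 ≡ 3 × q ∣ n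

    through : ∀ {m n} → m ∣ n → P m → P n
    through m∣n (q , pq , q%4≡3 , q∣m) = q , pq , q%4≡3 , ∣-trans q∣m m∣n

    step : ∀ n → (∀ {m} → m < n → m % 4 ≡ 3 → P m) → n % 4 ≡ 3 → P n
    step n rec n%4≡3 with prime? n
    ... | yes n-prime = n , n-prime , n%4≡3 , ∣-refl
    ... | no ¬n-prime
      with ¬prime⇒composite {{n>1⇒nonTrivial (<⇒≤ (%4≡3⇒2<n n%4≡3))}} ¬n-prime
    ... | hasNonTrivialDivisor d<n d∣n@(divides c n≡c*d)
      with [m*n]%4≡3⇒m%4≡3⊎n%4≡3 c _ (trans (cong (_% 4) (sym n≡c*d)) n%4≡3)
    ...   | inj₁ c%4≡3 = through (quotient-∣ d∣n) (rec c<n c%4≡3)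
      where
        instance _ = %4≡3⇒nonZero n%4≡3
        c<n = quotient-< d∣n
    ...   | inj₂ d%4≡3 = through d∣n (rec d<n d%4≡3)

sumOfSquares⇒commonPrime≡3[4] : ∀ m n x y → m % 4 ≡ 3 → m * n ≡ x * x + y * y
  → ∃ λ q → Prime q × q % 4 ≡ 3 × q ∣ m × q ∣ n
sumOfSquares⇒commonPrime≡3[4] m n = <-rec P step m
  where
    Common : ℕ → Set
    Common m = ∃ λ q → Prime q × q % 4 ≡ 3 × q ∣ m × q ∣ n

    P : ℕ → Set
    P m = ∀ x y → m % 4 ≡ 3 → m * n ≡ x * x + y * y → Common m

    through : ∀ {k m} → k ∣ m → Common k → Common m
    through k∣m (q , pq , q%4≡3 , q∣k , q∣n) = q , pq , q%4≡3 , ∣-trans q∣k k∣m , q∣n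

    step : ∀ m → (∀ {k} → k < m → P k) → P m
    step m rec x y m%4≡3 mn≡x²+y² with ∃prime≡3[4]∣ m m%4≡3
    ... | q , pq , q%4≡3 , divides m₁ refl
      with prime≡3[4]-divideOut pq q%4≡3 m₁ n x y mn≡x²+y²
    ... | x′ , y′ , m₁n≡q*s
      with euclidsLemma m₁ n pq (subst (q ∣_) (sym m₁n≡q*s) (m∣m*n _))
    ... | inj₂ q∣n = q , pq , q%4≡3 , n∣m*n m₁ , q∣n
    ... | inj₁ (divides m₂ refl) =
      through (∣m⇒∣m*n q (m∣m*n q)) (rec m₂<m x′ y′ m₂%4≡3 m₂n≡x′²+y′²)
      where
        instance _ = prime⇒nonZero pq
        m≡m₂*[q*q] : m₂ * q * q ≡ m₂ * (q * q)
        m≡m₂*[q*q] = *-assoc m₂ q q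
        m₂%4≡3 : m₂ % 4 ≡ 3
        m₂%4≡3 = trans (sym ([m*n]%d≡m%d m₂ (%4≡3⇒[n*n]%4≡1 q q%4≡3)))
                       (trans (cong (_% 4) (sym m≡m₂*[q*q])) m%4≡3)
        m₂<m : m₂ < m₂ * q * q
        m₂<m = subst (m₂ <_) (sym m≡m₂*[q*q])
          (m<m*n m₂ (q * q) {{%4≡3⇒nonZero m₂%4≡3}}
                 (<-≤-trans (<-trans (n<1+n 1) (%4≡3⇒2<n q%4≡3)) (m≤m*n q q)))
        m₂n≡x′²+y′² : m₂ * n ≡ x′ * x′ + y′ * y′
        m₂n≡x′²+y′² = *-cancelˡ-≡ _ _ q (trans (rearrange q m₂ n) m₁n≡q*s)
          where
            rearrange : ∀ q m n → q * (m * n) ≡ m * q * n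
            rearrange = solve-∀

x²+y²+[z^[2+j]]²≢N² : ∀ {N} → N % 4 ≡ 3 → (∀ q → Prime q → q % 4 ≡ 3 → q ∣ N → N < q ^ 2)
  → ∀ x y z j → z > 0 → 2 ∣ z → x ^ 2 + y ^ 2 + (z ^ (2 + j)) ^ 2 ≢ N ^ 2
x²+y²+[z^[2+j]]²≢N² {N} N%4≡3 N<q² x y z j z>0 2∣z eq =
  noCommonPrime (sumOfSquares⇒commonPrime≡3[4] A (A + 2 * w) x y A%4≡3 A[A+2w]≡x²+y²)
  where
    instance _ = >-nonZero z>0
    w = z ^ (2 + j)

    w≤N : w ≤ N
    w≤N = ≮⇒≥ λ N<w →
      <⇒≱ (^-monoˡ-< 2 N<w) (subst (w ^ 2 ≤_) eq (m≤n+m (w ^ 2) (x ^ 2 + y ^ 2)))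

    A = N ∸ w
    w+A≡N : w + A ≡ N
    w+A≡N = m+[n∸m]≡n w≤N

    A%4≡3 : A % 4 ≡ 3
    A%4≡3 = trans (sym (%-remove-+ˡ A (2∣m⇒4∣m^[2+n] j 2∣z))) (trans (cong (_% 4) w+A≡N) N%4≡3)

    A[A+2w]≡x²+y² : A * (A + 2 * w) ≡ x * x + y * y
    A[A+2w]≡x²+y² = +-cancelʳ-≡ (w ^ 2) _ _ (begin
      A * (A + 2 * w) + w ^ 2     ≡⟨ differenceOfSquares w A ⟩
      (w + A) ^ 2                 ≡⟨ cong (_^ 2) w+A≡N ⟩
      N ^ 2                       ≡⟨ sym eq ⟩
      x ^ 2 + y ^ 2 + w ^ 2       ≡⟨ cong₂ (λ s t → s + t + w ^ 2) (m^2≡m*m x) (m^2≡m*m y) ⟩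
      x * x + y * y + w ^ 2       ∎)
      where
        open ≡-Reasoning
        differenceOfSquares : ∀ w A → A * (A + 2 * w) + w * (w * 1) ≡ (w + A) * ((w + A) * 1)
        differenceOfSquares = solve-∀

    noCommonPrime : ¬ ∃ λ q → Prime q × q % 4 ≡ 3 × q ∣ A × q ∣ A + 2 * w
    noCommonPrime (q , pq , q%4≡3 , q∣A , q∣A+2w) = <-irrefl refl (begin-strict
      N      <⟨ N<q² q pq q%4≡3 (subst (q ∣_) w+A≡N (∣m∣n⇒∣m+n q∣w q∣A)) ⟩
      q ^ 2  ≤⟨ ^-monoˡ-≤ 2 (∣⇒≤ (prime∣m^n⇒∣m pq z (2 + j) q∣w)) ⟩
      z ^ 2  ≤⟨ ^-monoʳ-≤ z (m≤m+n 2 j) ⟩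
      w      ≤⟨ w≤N ⟩
      N      ∎)
      where
        open ≤-Reasoning
        q∣w : q ∣ w
        q∣w = prime>2∧∣2*n⇒∣n pq (%4≡3⇒2<n q%4≡3) (∣m+n∣m⇒∣n q∣A+2w q∣A)

%4≡2∧6≤k⇒k≡[2+j]*2 : ∀ {k} → k % 4 ≡ 2 → 6 ≤ k → ∃ λ j → k ≡ (2 + j) * 2
%4≡2∧6≤k⇒k≡[2+j]*2 {k} k%4≡2 6≤k = k / 2 ∸ 2 , (begin
  k                     ≡⟨ m≡m%n+[m/n]*n k 2 ⟩
  k % 2 + k / 2 * 2     ≡⟨ cong (_+ k / 2 * 2) k%2≡0 ⟩
  k / 2 * 2             ≡⟨ cong (_* 2) (sym (m+[n∸m]≡n (/-monoˡ-≤ 2 (≤-trans (m≤n+m 4 2) 6≤k)))) ⟩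
  (2 + (k / 2 ∸ 2)) * 2 ∎)
  where
    open ≡-Reasoning
    k%2≡0 : k % 2 ≡ 0
    k%2≡0 = trans (sym (m∣n⇒o%n%m≡o%m 2 4 k (divides 2 refl))) (cong (_% 2) k%4≡2)

[n*p]%4≡3 : ∀ {n p} → n % 8 ≡ 1 → p % 8 ≡ 7 → (n * p) % 4 ≡ 3
[n*p]%4≡3 {n} {p} n%8≡1 p%8≡7 = begin
  (n * p) % 4      ≡⟨ sym (m∣n⇒o%n%m≡o%m 4 8 (n * p) (divides 2 refl)) ⟩
  (n * p) % 8 % 4  ≡⟨ cong (λ t → t % 8 % 4) (*-comm n p) ⟩
  (p * n) % 8 % 4  ≡⟨ cong (_% 4) ([m*n]%d≡m%d p n%8≡1) ⟩
  p % 8 % 4        ≡⟨ cong (_% 4) p%8≡7 ⟩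
  3                ∎
  where open ≡-Reasoning

prime∣n*p⇒n*p<q² : ∀ {n p q} → Prime p → n < p → Prime q → ¬ q ∣ n → q ∣ n * p → n * p < q ^ 2
prime∣n*p⇒n*p<q² {n} {p} {q} pp n<p pq q∤n q∣np with euclidsLemma n p pq q∣np
... | inj₁ q∣n = contradiction q∣n q∤n
... | inj₂ q∣p with prime⇒irreducible pp q∣p
...   | inj₁ refl = contradiction pq ¬prime[1]
...   | inj₂ refl = subst (n * q <_) (sym (m^2≡m*m q)) (*-monoˡ-< q {{prime⇒nonZero pq}} n<p)

prime≡3[4]∤n : ∀ {n q} → (n ≡ 1 ⊎ ((r : ℕ) → Prime r → r ∣ n → r % 4 ≡ 1))
  → Prime q → q % 4 ≡ 3 → ¬ q ∣ n
prime≡3[4]∤n (inj₁ refl)         pq _      q∣1 = prime∤1 pq q∣1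
prime≡3[4]∤n (inj₂ factors≡1[4]) pq q%4≡3 q∣n with trans (sym (factors≡1[4] _ pq q∣n)) q%4≡3
... | ()

theorem3 : (k p n : ℕ) → k % 4 ≡ 2 → k ≥ 6 → Prime p → p % 8 ≡ 7
    → n > 0 → n % 8 ≡ 1 → n < p
    → (n ≡ 1 ⊎ ((q : ℕ) → Prime q → q ∣ n → q % 4 ≡ 1))
    → ¬ (∃ λ x → ∃ λ y → ∃ λ z → x > 0 × y > 0 × z > 0 × 2 ∣ z
          × x ^ 2 + y ^ 2 + z ^ k ≡ (n * p) ^ 2)
theorem3 k p n k%4≡2 k≥6 pp p%8≡7 _ n%8≡1 n<p n-factors (x , y , z , _ , _ , z>0 , 2∣z , eq)
  with %4≡2∧6≤k⇒k≡[2+j]*2 k%4≡2 k≥6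
... | j , refl = x²+y²+[z^[2+j]]²≢N² ([n*p]%4≡3 {n} {p} n%8≡1 p%8≡7)
                   (λ q pq q%4≡3 → prime∣n*p⇒n*p<q² pp n<p pq (prime≡3[4]∤n n-factors pq q%4≡3))
                   x y z j z>0 2∣z (trans (cong (x ^ 2 + y ^ 2 +_) (^-*-assoc z (2 + j) 2)) eq)
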